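{- Let $\mathcal D$ be any family of dependencies and $\phi$ any formula of $\mathrm{FO}(\mathcal D)$, and let $u_0,u_1,v$ be distinct variables not occurring in $\phi$. Then $\Diamond\phi$ is logically equivalent to \[ \exists u_0 u_1\exists v\,\big(=\!\!(u_0)\wedge=\!\!(u_1)\wedge(v=u_0\vee v=u_1)\wedge(\phi\upharpoonright v=u_1)\wedge\not=\!\!(v)\big). \]
   Context: Team semantics: models have domain $\mathrm{dom}(M)$ with at least two elements. A team $X$ over $M$ with domain a finite set of variables $V$ is a set of assignments $s:V\to\mathrm{dom}(M)$; for a tuple $\bar x$ of variables, $X(\bar x)=\{s(\bar x): s\in X\}$. Formulas are in negation normal form, and $M\models_X\phi$ is defined by: for a first-order literal $\alpha$, $M\models_X\alpha$ iff every $s\in X$ satisfies $\alpha$ in the Tarskian sense; $M\models_X\psi\vee\chi$ iff $X=Y\cup Z$ for some $Y,Z$ with $M\models_Y\psi$ and $M\models_Z\chi$; $M\models_X\psi\wedge\chi$ iff both hold on $X$; $M\models_X\exists v\psi$ iff there is $H:X\to\mathcal P(\mathrm{dom}(M))\setminus\{\emptyset\}$ with $M\models_{X[H/v]}\psi$, where $X[H/v]=\{s[m/v]: s\in X, m\in H(s)\}$; $\exists u_0u_1$ abbreviates $\exists u_0\exists u_1$; $M\models_X\forall v\psi$ iff $M\models_{X[M/v]}\psi$, where $X[M/v]=\{s[m/v]: s\in X, m\in\mathrm{dom}(M)\}$. Two formulas are logically equivalent if satisfied by the same teams in all models. A dependency is a class $\mathbf D$ of structures $(\mathrm{dom}(M),R)$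 closed under isomorphism; $M\models_X\mathbf D\bar x$ iff $(\mathrm{dom}(M),X(\bar x))\in\mathbf D$; $\mathrm{FO}(\mathcal D)$ is first-order logic with all atoms $\mathbf D\bar x$, $\mathbf D\in\mathcal D$. Constancy atom: $M\models_X=\!\!(u)$ iff $s(u)=s'(u)$ for all $s,s'\in X$. Inconstancy atom: $M\models_X\not=\!\!(v)$ iff $|X(v)|>1$. For first-order $\theta$, $(\phi\upharpoonright\theta)$ denotes $(\neg\theta)\vee(\theta\wedge\phi)$, $\neg\theta$ being the negation normal form of the negation of $\theta$. Possibility operator: $M\models_X\Diamond\phi$ iff there exists a nonempty $Y\subseteq X$ with $M\models_Y\phi$. -}

module Defs where

open import Level using (Level; Lift; lift; lower) renaming (suc to lsuc; zero to lzero)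
open import Data.Nat using (ℕ; _≡ᵇ_)
open import Data.Bool using (Bool; true; false; if_then_else_)
open import Data.Vec using (Vec; []; _∷_; map)
open import Data.Vec.Relation.Unary.Any using (Any)
open import Data.Product using (Σ; _×_; _,_; proj₁; proj₂; ∃)
open import Data.Sum using (_⊎_; inj₁; inj₂; [_,_])
open import Data.Empty using (⊥)
open import Relation.Nullary using (¬_)
open import Relation.Binary.PropositionalEquality using (_≡_; refl; _≗_; subst; sym; cong)
open import Function.Bundles using (Inverse; _↔_; _⇔_; Equivalence)

Var : Set
Var = ℕ

record Signature : Set₁ where
  field
    Fun   : Set
    funAr : Fun → ℕ
    Rel   : Set
    relAr : Rel → ℕ

module _ (σ : Signature) where
  open Signature σ

  data Term : Set where
    var : Var → Term
    app : (f : Fun) → Vec Term (funAr f) → Term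

-- Dependencies: classes of structures (A , R), R an n-ary relation on A,
-- closed under isomorphism.  Relations are predicates Vec A n → Set.

record Dependency : Set₁ where
  field
    arity : ℕ
    holds : (A : Set) → (Vec A arity → Set) → Set
    iso-closed : ∀ {A B : Set} (f : A ↔ B)
                 (R : Vec A arity → Set) (R' : Vec B arity → Set) →
                 (∀ t → R t ⇔ R' (map (Inverse.to f) t)) →
                 holds A R → holds B R'

record Family : Set₂ where
  field
    Idx : Set
    dep : Idx → Dependency

module _ (σ : Signature) (𝒟 : Family) where
  open Signature σ
  open Family 𝒟

  data Formula : Set where
    _≐_  : Term σ → Term σ → Formula
    _≠_  : Term σ → Term σ → Formula
    rel  : (r : Rel) → Vec (Term σ) (relAr r) → Formula
    nrel : (r : Rel) → Vec (Term σ) (relAr r) → Formula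
    atom : (i : Idx) → Vec Var (Dependency.arity (dep i)) → Formula
    _∧'_ : Formula → Formula → Formula
    _∨'_ : Formula → Formula → Formula
    ex   : Var → Formula → Formula
    all  : Var → Formula → Formula

module _ {σ : Signature} where
  open Signature σ

  mutual
    OccT : Var → Term σ → Set
    OccT x (var y)    = x ≡ y
    OccT x (app f ts) = OccTs x ts

    OccTs : ∀ {n} → Var → Vec (Term σ) n → Set
    OccTs x []       = ⊥
    OccTs x (t ∷ ts) = OccT x t ⊎ OccTs x ts

module _ {σ : Signature} {𝒟 : Family} where

  Occ : Var → Formula σ 𝒟 → Set
  Occ x (t ≐ t')   = OccT x t ⊎ OccT x t'
  Occ x (t ≠ t')   = OccT x t ⊎ OccT x t'
  Occ x (rel r ts) = OccTs x ts
  Occ x (nrel r ts) = OccTs x ts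
  Occ x (atom i xs) = Any (x ≡_) xs
  Occ x (φ ∧' ψ)   = Occ x φ ⊎ Occ x ψ
  Occ x (φ ∨' ψ)   = Occ x φ ⊎ Occ x ψ
  Occ x (ex y φ)   = x ≡ y ⊎ Occ x φ
  Occ x (all y φ)  = x ≡ y ⊎ Occ x φ

record Model (σ : Signature) : Set₁ where
  open Signature σ
  field
    Dom    : Set
    funI   : (f : Fun) → Vec Dom (funAr f) → Dom
    relI   : (r : Rel) → Vec Dom (relAr r) → Set
    two    : Σ Dom λ a → Σ Dom λ b → ¬ (a ≡ b)

-- Assignments and teams.  An assignment is a total map Var → Dom
-- (values outside the variables of interest are irrelevant);
-- a team is a set (predicate) of assignments.

module _ {σ : Signature} (M : Model σ) where
  open Signature σ
  open Model M

  Assignment : Set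
  Assignment = Var → Dom

  Team : Set₁
  Team = Assignment → Set

  upd : Assignment → Var → Dom → Assignment
  upd s v m x = if x ≡ᵇ v then m else s x

  mutual
    evalT : Assignment → Term σ → Dom
    evalT s (var x)    = s x
    evalT s (app f ts) = funI f (evalTs s ts)

    evalTs : ∀ {n} → Assignment → Vec (Term σ) n → Vec Dom n
    evalTs s []       = []
    evalTs s (t ∷ ts) = evalT s t ∷ evalTs s ts

  supp : Team → Var → (Assignment → Dom → Set) → Team
  supp X v H t = Σ Assignment λ s → X s × Σ Dom λ m → H s m × (t ≗ upd s v m)

  dupl : Team → Var → Team
  dupl X v t = Σ Assignment λ s → X s × Σ Dom λ m → t ≗ upd s v m

  values : Team → ∀ {n} → Vec Var n → Vec Dom n → Set
  values X xs d = Σ Assignment λ s → X s × (map s xs ≡ d)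

  _⊆T_ : Team → Team → Set
  Y ⊆T X = ∀ s → Y s → X s

  Flat : Team → (Assignment → Set) → Set₁
  Flat X P = Lift (lsuc lzero) (∀ s → X s → P s)

  sat : {𝒟 : Family} → Team → Formula σ 𝒟 → Set₁
  sat X (t ≐ t')    = Flat X λ s → evalT s t ≡ evalT s t'
  sat X (t ≠ t')    = Flat X λ s → ¬ (evalT s t ≡ evalT s t')
  sat X (rel r ts)  = Flat X λ s → relI r (evalTs s ts)
  sat X (nrel r ts) = Flat X λ s → ¬ relI r (evalTs s ts)
  sat {𝒟} X (atom i xs) =
    Lift (lsuc lzero) (Dependency.holds (Family.dep 𝒟 i) Dom (values X xs))
  sat X (φ ∧' ψ) = sat X φ × sat X ψ
  sat X (φ ∨' ψ) = Σ Team λ Y → Σ Team λ Z →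
    (X ⊆T λ s → Y s ⊎ Z s) × (Y ⊆T X) × (Z ⊆T X) × sat Y φ × sat Z ψ
  sat X (ex v φ) = Σ (Assignment → Dom → Set) λ H →
    (∀ s → X s → Σ Dom (H s)) × sat (supp X v H) φ
  sat X (all v φ) = sat (dupl X v) φ

  ◇sat : {𝒟 : Family} → Team → Formula σ 𝒟 → Set₁
  ◇sat X φ = Σ Team λ Y → (Y ⊆T X) × (Σ Assignment Y) × sat Y φ

private
  tr : ∀ {A B : Set} (f : A ↔ B) (R : Vec A 1 → Set) (R' : Vec B 1 → Set) →
       (∀ t → R t ⇔ R' (map (Inverse.to f) t)) → ∀ y → R' (y ∷ []) → R (Inverse.from f y ∷ [])
  tr f R R' e y r' = Equivalence.from (e (Inverse.from f y ∷ []))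
    (subst (λ z → R' (z ∷ [])) (sym (Inverse.strictlyInverseˡ f y)) r')

constancyD : Dependency
constancyD = record
  { arity = 1
  ; holds = λ A R → ∀ x y → R (x ∷ []) → R (y ∷ []) → x ≡ y
  ; iso-closed = λ f R R' e h x y rx ry →
      subst (λ z → z ≡ y) (Inverse.strictlyInverseˡ f x)
        (subst (λ z → Inverse.to f (Inverse.from f x) ≡ z) (Inverse.strictlyInverseˡ f y)
          (cong (Inverse.to f) (h _ _ (tr f R R' e x rx) (tr f R R' e y ry))))
  }

inconstancyD : Dependency
inconstancyD = record
  { arity = 1
  ; holds = λ A R → Σ A λ x → Σ A λ y → R (x ∷ []) × R (y ∷ []) × ¬ (x ≡ y)
  ; iso-closed = λ f R R' e → λ { (x , y , rx , ry , ne) →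
      Inverse.to f x , Inverse.to f y ,
      Equivalence.to (e (x ∷ [])) rx , Equivalence.to (e (y ∷ [])) ry ,
      λ eq → ne (subst₂' (Inverse.strictlyInverseʳ f x) (Inverse.strictlyInverseʳ f y)
                   (cong (Inverse.from f) eq)) }
  }
  where
    subst₂' : ∀ {A : Set} {a a' b b' : A} → a ≡ a' → b ≡ b' → a ≡ b → a' ≡ b'
    subst₂' refl refl p = p

extend : Family → Family
extend 𝒟 = record
  { Idx = Family.Idx 𝒟 ⊎ Bool
  ; dep = [ Family.dep 𝒟 , (λ b → if b then constancyD else inconstancyD) ]
  }

module _ {σ : Signature} {𝒟 : Family} where

  embed : Formula σ 𝒟 → Formula σ (extend 𝒟)
  embed (t ≐ t')    = t ≐ t'
  embed (t ≠ t')    = t ≠ t'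
  embed (rel r ts)  = rel r ts
  embed (nrel r ts) = nrel r ts
  embed (atom i xs) = atom (inj₁ i) xs
  embed (φ ∧' ψ)    = embed φ ∧' embed ψ
  embed (φ ∨' ψ)    = embed φ ∨' embed ψ
  embed (ex v φ)    = ex v (embed φ)
  embed (all v φ)   = all v (embed φ)

  =⟨_⟩ : Var → Formula σ (extend 𝒟)
  =⟨ u ⟩ = atom (inj₂ true) (u ∷ [])

  ≠⟨_⟩ : Var → Formula σ (extend 𝒟)
  ≠⟨ u ⟩ = atom (inj₂ false) (u ∷ [])

  -- (φ ↾ θ) = (¬θ) ∨ (θ ∧ φ), here for θ the literal  v = u
  restrictEq : Formula σ (extend 𝒟) → Var → Var → Formula σ (extend 𝒟)
  restrictEq φ v u = (var v ≠ var u) ∨' ((var v ≐ var u) ∧' φ)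

  diamondTranslation : Formula σ 𝒟 → Var → Var → Var → Formula σ (extend 𝒟)
  diamondTranslation φ u₀ u₁ v =
    ex u₀ (ex u₁ (ex v
      (=⟨ u₀ ⟩ ∧' (=⟨ u₁ ⟩ ∧'
        (((var v ≐ var u₀) ∨' (var v ≐ var u₁)) ∧'
          (restrictEq (embed φ) v u₁ ∧' ≠⟨ v ⟩))))))

-- The translation marks a nonempty subteam Y witnessing ◇φ with fresh
-- variables: u₀ and u₁ are constants a ≠ b, and v takes
-- the value a everywhere and additionally the value b on the assignments
-- extending Y.  Then "φ ↾ v = u₁" evaluates φ exactly on (a copy of) Y,
-- while ≠(v) forces the b-part, hence Y, to be nonempty.  Both directions
-- rest on locality: satisfaction only depends on the values of the
-- variables occurring in the formula.
module Submission where

open import Defs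
open import Data.Product using (_×_)
open import Relation.Nullary using (¬_)
open import Relation.Binary.PropositionalEquality using (_≡_)

open import Level using (lift)
open import Data.Nat using (_≡ᵇ_)
open import Data.Nat.Properties using (≡ᵇ⇒≡; ≡⇒≡ᵇ)
open import Data.Bool using (true; false)
open import Data.Vec using (Vec; []; _∷_; map)
open import Data.Vec.Properties using (map-id)
open import Data.Vec.Relation.Unary.Any using (Any; here; there)
open import Data.Product using (Σ; _,_; proj₁; proj₂)
open import Data.Sum using (_⊎_; inj₁; inj₂)
import Data.Sum as Sum
import Data.Product as Product
open import Data.Empty using (⊥-elim)
open import Relation.Binary.PropositionalEquality
  using (_≢_; refl; sym; trans; cong; cong₂; subst)
open import Function using (_∘_)
open import Function.Bundles using (_⇔_; mk⇔)
open import Function.Construct.Identity using (↔-id)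

map-cong-on : ∀ {A B : Set} {n} (xs : Vec A n) {f g : A → B} →
              (∀ x → Any (x ≡_) xs → f x ≡ g x) → map f xs ≡ map g xs
map-cong-on []       f≐g = refl
map-cong-on (x ∷ xs) f≐g = cong₂ _∷_ (f≐g x (here refl)) (map-cong-on xs (λ y o → f≐g y (there o)))

holds-resp-⇔ : (D : Dependency) {A : Set} {R R' : Vec A (Dependency.arity D) → Set} →
               (∀ t → R t ⇔ R' t) → Dependency.holds D A R → Dependency.holds D A R'
holds-resp-⇔ D {A} {R} {R'} R⇔R' =
  Dependency.iso-closed D (↔-id A) R R' (λ t → subst (λ u → R t ⇔ R' u) (sym (map-id t)) (R⇔R' t))

module TeamSemantics {σ : Signature} (M : Model σ) where
  open Model M

  upd-≡ : ∀ s v m → upd M s v m v ≡ m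
  upd-≡ s v m with v ≡ᵇ v | ≡⇒≡ᵇ v v refl
  ... | true  | _ = refl
  ... | false | ()

  upd-≢ : ∀ s {v} m {x} → x ≢ v → upd M s v m x ≡ s x
  upd-≢ s {v} m {x} x≢v with x ≡ᵇ v | ≡ᵇ⇒≡ x v
  ... | true  | x≡v = ⊥-elim (x≢v (x≡v _))
  ... | false | _   = refl

  mutual
    evalT-cong : ∀ (t : Term σ) {s s'} → (∀ x → OccT x t → s x ≡ s' x) →
                 evalT M s t ≡ evalT M s' t
    evalT-cong (var x)    s≐s' = s≐s' x refl
    evalT-cong (app f ts) s≐s' = cong (funI f) (evalTs-cong ts s≐s')

    evalTs-cong : ∀ {n} (ts : Vec (Term σ) n) {s s'} → (∀ x → OccTs x ts → s x ≡ s' x) →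
                  evalTs M s ts ≡ evalTs M s' ts
    evalTs-cong []       s≐s' = refl
    evalTs-cong (t ∷ ts) s≐s' =
      cong₂ _∷_ (evalT-cong t (λ x o → s≐s' x (inj₁ o))) (evalTs-cong ts (λ x o → s≐s' x (inj₂ o)))

  AgreeOn : (Var → Set) → Assignment M → Assignment M → Set
  AgreeOn V s t = ∀ x → V x → s x ≡ t x

  agree-sym : ∀ {V s t} → AgreeOn V s t → AgreeOn V t s
  agree-sym s≐t x Vx = sym (s≐t x Vx)

  agree-trans : ∀ {V s t r} → AgreeOn V s t → AgreeOn V t r → AgreeOn V s r
  agree-trans s≐t t≐r x Vx = trans (s≐t x Vx) (t≐r x Vx)

  upd-agree : ∀ {V s s'} v m → AgreeOn V s s' → AgreeOn V (upd M s v m) (upd M s' v m)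
  upd-agree v m s≐s' x Vx with x ≡ᵇ v
  ... | true  = refl
  ... | false = s≐s' x Vx

  _∈[_]_ : Assignment M → (Var → Set) → Team M → Set
  s ∈[ V ] X = Σ (Assignment M) λ t → X t × AgreeOn V s t

  _⊆[_]_ : Team M → (Var → Set) → Team M → Set
  X ⊆[ V ] Y = ∀ s → X s → s ∈[ V ] Y

  _≈[_]_ : Team M → (Var → Set) → Team M → Set
  X ≈[ V ] Y = X ⊆[ V ] Y × Y ⊆[ V ] X

  _∩_ : Team M → (Assignment M → Set) → Team M
  (X ∩ P) s = X s × P s

  ⊆[]-trans : ∀ {V X Y Z} → X ⊆[ V ] Y → Y ⊆[ V ] Z → X ⊆[ V ] Z
  ⊆[]-trans X⊆Y Y⊆Z s s∈X with X⊆Y s s∈X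
  ... | t , t∈Y , s≐t with Y⊆Z t t∈Y
  ... | r , r∈Z , t≐r = r , r∈Z , agree-trans s≐t t≐r

  ⊆⇒⊆[] : ∀ {V} {X Y : Team M} → (∀ s → X s → Y s) → X ⊆[ V ] Y
  ⊆⇒⊆[] X⊆Y s s∈X = s , X⊆Y s s∈X , λ _ _ → refl

  ≈[]-∩ : ∀ {V X Y} → Y ⊆[ V ] X → Y ≈[ V ] (X ∩ (_∈[ V ] Y))
  ≈[]-∩ Y⊆X = (λ s s∈Y → let (t , t∈X , s≐t) = Y⊆X s s∈Y in t , (t∈X , s , s∈Y , agree-sym s≐t) , s≐t)
            , (λ _ → proj₂)

  supp-intro : ∀ {X H s m} v → X s → H s m → supp M X v H (upd M s v m)
  supp-intro v s∈X h = _ , s∈X , _ , h , λ _ → refl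

  supp-elim : ∀ {X H t} v → supp M X v H t →
              Σ (Assignment M) λ s → X s × H s (t v) × (∀ x → x ≢ v → t x ≡ s x)
  supp-elim {H = H} v (s , s∈X , m , h , t≗s[m/v]) =
    s , s∈X , subst (H s) (sym (trans (t≗s[m/v] v) (upd-≡ s v m))) h ,
    λ x x≢v → trans (t≗s[m/v] x) (upd-≢ s m x≢v)

  supp-⊆[] : ∀ {V X H} v → (∀ x → V x → x ≢ v) → supp M X v H ⊆[ V ] X
  supp-⊆[] v V⇒≢v t t∈ with supp-elim v t∈
  ... | s , s∈X , _ , t≐s = s , s∈X , λ x Vx → t≐s x (V⇒≢v x Vx)

  transferChoice : (Var → Set) → Team M → (Assignment M → Dom → Set) → Assignment M → Dom → Set
  transferChoice V X H s' m = Σ (Assignment M) λ s → X s × AgreeOn V s' s × H s m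

  supp-≈[] : ∀ {V X X' H} v → X ≈[ V ] X' →
             supp M X v H ≈[ V ] supp M X' v (transferChoice V X H)
  supp-≈[] v (X⊆X' , X'⊆X) =
    (λ { t (s , s∈X , m , h , t≗) → let (s' , s'∈X' , s≐s') = X⊆X' s s∈X in
          upd M s' v m , (s' , s'∈X' , m , (s , s∈X , agree-sym s≐s' , h) , (λ _ → refl)) ,
          λ x Vx → trans (t≗ x) (upd-agree v m s≐s' x Vx) })
    , (λ { t' (s' , _ , m , (s , s∈X , s'≐s , h) , t'≗) →
          upd M s v m , supp-intro v s∈X h , λ x Vx → trans (t'≗ x) (upd-agree v m s'≐s x Vx) })

  dupl-≈[] : ∀ {V X X'} v → X ≈[ V ] X' → dupl M X v ≈[ V ] dupl M X' v
  dupl-≈[] v (X⊆X' , X'⊆X) = transfer X⊆X' , transfer X'⊆X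
    where
      transfer : ∀ {X X'} → X ⊆[ _ ] X' → dupl M X v ⊆[ _ ] dupl M X' v
      transfer X⊆X' t (s , s∈X , m , t≗) = let (s' , s'∈X' , s≐s') = X⊆X' s s∈X in
        upd M s' v m , (s' , s'∈X' , m , λ _ → refl) , λ x Vx → trans (t≗ x) (upd-agree v m s≐s' x Vx)

  Flat-⊆[] : ∀ {V X X'} {P : Assignment M → Set} →
             (∀ {s s'} → AgreeOn V s s' → P s' → P s) → X' ⊆[ V ] X → Flat M X P → Flat M X' P
  Flat-⊆[] P-resp X'⊆X (lift X⊨P) =
    lift λ s' s'∈X' → let (s , s∈X , s'≐s) = X'⊆X s' s'∈X' in P-resp s'≐s (X⊨P s s∈X)

  values-⊆[] : ∀ {V X X' n} (xs : Vec Var n) → (∀ x → Any (x ≡_) xs → V x) →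
               X ⊆[ V ] X' → ∀ d → values M X xs d → values M X' xs d
  values-⊆[] xs xs⊆V X⊆X' d (s , s∈X , s[xs]≡d) = let (s' , s'∈X' , s≐s') = X⊆X' s s∈X in
    s' , s'∈X' , trans (sym (map-cong-on xs (λ x o → s≐s' x (xs⊆V x o)))) s[xs]≡d

  locality : ∀ {𝒟} (φ : Formula σ 𝒟) {V X X'} → (∀ x → Occ x φ → V x) →
             X ≈[ V ] X' → sat M X φ → sat M X' φ
  locality (t ≐ t') occ (_ , X'⊆X) = Flat-⊆[] (λ s≐s' e →
    trans (evalT-cong t (λ x o → s≐s' x (occ x (inj₁ o))))
          (trans e (sym (evalT-cong t' (λ x o → s≐s' x (occ x (inj₂ o))))))) X'⊆X
  locality (t ≠ t') occ (_ , X'⊆X) = Flat-⊆[] (λ s≐s' ne e → ne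
    (trans (sym (evalT-cong t (λ x o → s≐s' x (occ x (inj₁ o)))))
           (trans e (evalT-cong t' (λ x o → s≐s' x (occ x (inj₂ o))))))) X'⊆X
  locality (rel r ts) occ (_ , X'⊆X) = Flat-⊆[] (λ s≐s' →
    subst (relI r) (sym (evalTs-cong ts (λ x o → s≐s' x (occ x o))))) X'⊆X
  locality (nrel r ts) occ (_ , X'⊆X) = Flat-⊆[] (λ s≐s' ¬R R' → ¬R
    (subst (relI r) (evalTs-cong ts (λ x o → s≐s' x (occ x o))) R')) X'⊆X
  locality {𝒟} (atom i xs) occ (X⊆X' , X'⊆X) (lift X⊨D) = lift (holds-resp-⇔ (Family.dep 𝒟 i)
    (λ d → mk⇔ (values-⊆[] xs occ X⊆X' d) (values-⊆[] xs occ X'⊆X d)) X⊨D)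
  locality (φ ∧' ψ) occ X≈X' (X⊨φ , X⊨ψ) =
    locality φ (λ x o → occ x (inj₁ o)) X≈X' X⊨φ , locality ψ (λ x o → occ x (inj₂ o)) X≈X' X⊨ψ
  locality (φ ∨' ψ) {V} {X} {X'} occ (X⊆X' , X'⊆X) (Y , Z , X⊆Y∪Z , Y⊆X , Z⊆X , Y⊨φ , Z⊨ψ) =
    X' ∩ (_∈[ V ] Y) , X' ∩ (_∈[ V ] Z) , cover , (λ _ → proj₁) , (λ _ → proj₁) ,
    locality φ (λ x o → occ x (inj₁ o)) (≈[]-∩ (λ s s∈Y → X⊆X' s (Y⊆X s s∈Y))) Y⊨φ ,
    locality ψ (λ x o → occ x (inj₂ o)) (≈[]-∩ (λ s s∈Z → X⊆X' s (Z⊆X s s∈Z))) Z⊨ψ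
    where
      cover : ∀ s' → X' s' → (X' ∩ (_∈[ V ] Y)) s' ⊎ (X' ∩ (_∈[ V ] Z)) s'
      cover s' s'∈X' = let (s , s∈X , s'≐s) = X'⊆X s' s'∈X' in
        Sum.map (λ s∈Y → s'∈X' , s , s∈Y , s'≐s) (λ s∈Z → s'∈X' , s , s∈Z , s'≐s) (X⊆Y∪Z s s∈X)
  locality (ex v φ) occ (X⊆X' , X'⊆X) (H , H-total , X[H/v]⊨φ) =
    transferChoice _ _ H ,
    (λ s' s'∈X' → let (s , s∈X , s'≐s) = X'⊆X s' s'∈X' ; (m , h) = H-total s s∈X in
       m , s , s∈X , s'≐s , h) ,
    locality φ (λ x o → occ x (inj₂ o)) (supp-≈[] v (X⊆X' , X'⊆X)) X[H/v]⊨φ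
  locality (all v φ) occ X≈X' X[M/v]⊨φ =
    locality φ (λ x o → occ x (inj₂ o)) (dupl-≈[] v X≈X') X[M/v]⊨φ

  sat-embed⇒sat : ∀ {𝒟} X (φ : Formula σ 𝒟) → sat M X (embed φ) → sat M X φ
  sat-embed⇒sat X (t ≐ t')    p = p
  sat-embed⇒sat X (t ≠ t')    p = p
  sat-embed⇒sat X (rel r ts)  p = p
  sat-embed⇒sat X (nrel r ts) p = p
  sat-embed⇒sat X (atom i xs) p = p
  sat-embed⇒sat X (φ ∧' ψ) (p , q) = sat-embed⇒sat X φ p , sat-embed⇒sat X ψ q
  sat-embed⇒sat X (φ ∨' ψ) (Y , Z , c , Y⊆ , Z⊆ , p , q) =
    Y , Z , c , Y⊆ , Z⊆ , sat-embed⇒sat Y φ p , sat-embed⇒sat Z ψ q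
  sat-embed⇒sat X (ex v φ)  (H , H-total , p) = H , H-total , sat-embed⇒sat _ φ p
  sat-embed⇒sat X (all v φ) p = sat-embed⇒sat _ φ p

  sat⇒sat-embed : ∀ {𝒟} X (φ : Formula σ 𝒟) → sat M X φ → sat M X (embed φ)
  sat⇒sat-embed X (t ≐ t')    p = p
  sat⇒sat-embed X (t ≠ t')    p = p
  sat⇒sat-embed X (rel r ts)  p = p
  sat⇒sat-embed X (nrel r ts) p = p
  sat⇒sat-embed X (atom i xs) p = p
  sat⇒sat-embed X (φ ∧' ψ) (p , q) = sat⇒sat-embed X φ p , sat⇒sat-embed X ψ q
  sat⇒sat-embed X (φ ∨' ψ) (Y , Z , c , Y⊆ , Z⊆ , p , q) =
    Y , Z , c , Y⊆ , Z⊆ , sat⇒sat-embed Y φ p , sat⇒sat-embed Z ψ q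
  sat⇒sat-embed X (ex v φ)  (H , H-total , p) = H , H-total , sat⇒sat-embed _ φ p
  sat⇒sat-embed X (all v φ) p = sat⇒sat-embed _ φ p

  ∨-split : ∀ {𝒟} (φ ψ : Formula σ 𝒟) {X} (P Q : Assignment M → Set) →
            (∀ t → X t → P t ⊎ Q t) → sat M (X ∩ P) φ → sat M (X ∩ Q) ψ → sat M X (φ ∨' ψ)
  ∨-split _ _ P Q P∪Q X∩P⊨φ X∩Q⊨ψ =
    _ , _ , (λ t t∈X → Sum.map (t∈X ,_) (t∈X ,_) (P∪Q t t∈X)) , (λ _ → proj₁) , (λ _ → proj₁) ,
    X∩P⊨φ , X∩Q⊨ψ

  module _ {𝒟 : Family} {X : Team M} where

    =⟨⟩-intro : ∀ u c → (∀ s → X s → s u ≡ c) → sat M X (=⟨_⟩ {σ} {𝒟} u)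
    =⟨⟩-intro u c X⊨u≡c = lift λ { _ _ (s , s∈X , refl) (s' , s'∈X , refl) →
      trans (X⊨u≡c s s∈X) (sym (X⊨u≡c s' s'∈X)) }

    =⟨⟩-elim : ∀ {u s s'} → sat M X (=⟨_⟩ {σ} {𝒟} u) → X s → X s' → s u ≡ s' u
    =⟨⟩-elim (lift X⊨=u) s∈X s'∈X = X⊨=u _ _ (_ , s∈X , refl) (_ , s'∈X , refl)

    ≠⟨⟩-intro : ∀ {v s s'} → X s → X s' → s v ≢ s' v → sat M X (≠⟨_⟩ {σ} {𝒟} v)
    ≠⟨⟩-intro s∈X s'∈X s≢s' =
      lift (_ , _ , (_ , s∈X , refl) , (_ , s'∈X , refl) , s≢s')

    ≠⟨⟩-elim : ∀ {v} → sat M X (≠⟨_⟩ {σ} {𝒟} v) →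
               Σ (Assignment M) λ s → Σ (Assignment M) λ s' → X s × X s' × s v ≢ s' v
    ≠⟨⟩-elim (lift (_ , _ , (s , s∈X , refl) , (s' , s'∈X , refl) , x≢y)) =
      s , s' , s∈X , s'∈X , x≢y

  v≡u₁-somewhere : ∀ {X : Team M} {u₀ u₁ v s s'} →
                   (∀ t → X t → t v ≡ t u₀ ⊎ t v ≡ t u₁) → (∀ {t t'} → X t → X t' → t u₀ ≡ t' u₀) →
                   X s → X s' → s v ≢ s' v → Σ (Assignment M) λ t → X t × t v ≡ t u₁
  v≡u₁-somewhere {s = s} {s'} v∈u₀u₁ u₀-const s∈X s'∈X s≢s'
    with v∈u₀u₁ s s∈X | v∈u₀u₁ s' s'∈X
  ... | inj₂ e | _      = s , s∈X , e
  ... | inj₁ _ | inj₂ e = s' , s'∈X , e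
  ... | inj₁ e | inj₁ e' = ⊥-elim (s≢s' (trans e (trans (u₀-const s∈X s'∈X) (sym e'))))

module Diamond {σ : Signature} {𝒟 : Family} (φ : Formula σ 𝒟) (u₀ u₁ v : Var)
    (u₀≢u₁ : u₀ ≢ u₁) (u₀≢v : u₀ ≢ v) (u₁≢v : u₁ ≢ v)
    (u₀∉φ : ¬ Occ u₀ φ) (u₁∉φ : ¬ Occ u₁ φ) (v∉φ : ¬ Occ v φ)
    (M : Model σ) (X : Team M) where
  open Model M
  open TeamSemantics M

  Other : Var → Set
  Other x = x ≢ u₀ × x ≢ u₁ × x ≢ v

  φ⊆Other : ∀ x → Occ x φ → Other x
  φ⊆Other x x∈φ = (λ { refl → u₀∉φ x∈φ }) , (λ { refl → u₁∉φ x∈φ }) , (λ { refl → v∉φ x∈φ })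

  module Forward (Y : Team M) (Y⊆X : ∀ s → Y s → X s) where
    a b : Dom
    a = proj₁ two
    b = proj₁ (proj₂ two)

    a≢b : a ≢ b
    a≢b = proj₂ (proj₂ two)

    H₂ : Assignment M → Dom → Set
    H₂ t m = m ≡ a ⊎ (m ≡ b × t ∈[ Other ] Y)

    X₃ : Team M
    X₃ = supp M (supp M (supp M X u₀ (λ _ → _≡ a)) u₁ (λ _ → _≡ b)) v H₂

    pinned : Assignment M → Assignment M
    pinned s = upd M (upd M s u₀ a) u₁ b

    pinned-agree : ∀ s → AgreeOn Other (pinned s) s
    pinned-agree s x (x≢u₀ , x≢u₁ , _) = trans (upd-≢ (upd M s u₀ a) b x≢u₁) (upd-≢ s a x≢u₀)

    X₃-intro : ∀ {s m} → X s → H₂ (pinned s) m → X₃ (upd M (pinned s) v m)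
    X₃-intro s∈X = supp-intro v (supp-intro u₁ (supp-intro u₀ s∈X refl) refl)

    X₃-shape : ∀ t → X₃ t → t u₀ ≡ a × t u₁ ≡ b × H₂ t (t v)
    X₃-shape t t∈X₃ with supp-elim v t∈X₃
    ... | s₂ , s₂∈ , h₂ , t≐s₂ with supp-elim u₁ s₂∈
    ... | s₁ , s₁∈ , s₂u₁≡b , s₂≐s₁ with supp-elim u₀ s₁∈
    ... | _ , _ , s₁u₀≡a , _ =
      trans (t≐s₂ u₀ u₀≢v) (trans (s₂≐s₁ u₀ u₀≢u₁) s₁u₀≡a) ,
      trans (t≐s₂ u₁ u₁≢v) s₂u₁≡b ,
      Sum.map₂ (Product.map₂ λ (r , r∈Y , s₂≐r) →
                  r , r∈Y , agree-trans (λ x (_ , _ , x≢v) → t≐s₂ x x≢v) s₂≐r) h₂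

    X₃-u₀ : ∀ t → X₃ t → t u₀ ≡ a
    X₃-u₀ t t∈X₃ = proj₁ (X₃-shape t t∈X₃)

    X₃-u₁ : ∀ t → X₃ t → t u₁ ≡ b
    X₃-u₁ t t∈X₃ = proj₁ (proj₂ (X₃-shape t t∈X₃))

    X₃-v : ∀ t → X₃ t → t v ≡ a ⊎ t v ≡ b
    X₃-v t t∈X₃ = Sum.map₂ proj₁ (proj₂ (proj₂ (X₃-shape t t∈X₃)))

    Y≈[]X₃[v≡b] : Y ≈[ Other ] (X₃ ∩ (λ t → t v ≡ b))
    Y≈[]X₃[v≡b] =
      (λ s s∈Y → upd M (pinned s) v b ,
         (X₃-intro (Y⊆X s s∈Y) (inj₂ (refl , s , s∈Y , pinned-agree s)) , upd-≡ (pinned s) v b) ,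
         λ x Vx → sym (trans (upd-≢ (pinned s) b (proj₂ (proj₂ Vx))) (pinned-agree s x Vx)))
      , λ t (t∈X₃ , tv≡b) → b-branch⇒∈Y tv≡b (proj₂ (proj₂ (X₃-shape t t∈X₃)))
      where
        b-branch⇒∈Y : ∀ {t} → t v ≡ b → H₂ t (t v) → t ∈[ Other ] Y
        b-branch⇒∈Y tv≡b (inj₁ tv≡a)     = ⊥-elim (a≢b (trans (sym tv≡a) tv≡b))
        b-branch⇒∈Y _    (inj₂ (_ , t∈Y)) = t∈Y

    forward : Σ (Assignment M) Y → sat M Y φ → sat M X (diamondTranslation φ u₀ u₁ v)
    forward (s , s∈Y) Y⊨φ =
      _ , (λ _ _ → a , refl) , _ , (λ _ _ → b , refl) , H₂ , (λ _ _ → a , inj₁ refl) ,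
      =⟨⟩-intro {𝒟} u₀ a X₃-u₀ ,
      =⟨⟩-intro {𝒟} u₁ b X₃-u₁ ,
      ∨-split {extend 𝒟} (var v ≐ var u₀) (var v ≐ var u₁) (λ t → t v ≡ a) (λ t → t v ≡ b) X₃-v
        (lift λ t (t∈X₃ , tv≡a) → trans tv≡a (sym (X₃-u₀ t t∈X₃)))
        (lift λ t (t∈X₃ , tv≡b) → trans tv≡b (sym (X₃-u₁ t t∈X₃))) ,
      ∨-split (var v ≠ var u₁) ((var v ≐ var u₁) ∧' embed φ) (λ t → t v ≡ a) (λ t → t v ≡ b) X₃-v
        (lift λ t (t∈X₃ , tv≡a) tv≡tu₁ →
           a≢b (trans (sym tv≡a) (trans tv≡tu₁ (X₃-u₁ t t∈X₃))))
        ( (lift λ t (t∈X₃ , tv≡b) → trans tv≡b (sym (X₃-u₁ t t∈X₃)))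
        , sat⇒sat-embed _ φ (locality φ φ⊆Other Y≈[]X₃[v≡b] Y⊨φ)) ,
      ≠⟨⟩-intro {𝒟} (X₃-intro (Y⊆X s s∈Y) (inj₁ refl))
                (X₃-intro (Y⊆X s s∈Y) (inj₂ (refl , s , s∈Y , pinned-agree s)))
                (λ e → a≢b (trans (sym (upd-≡ (pinned s) v a)) (trans e (upd-≡ (pinned s) v b))))

  backward : sat M X (diamondTranslation φ u₀ u₁ v) → ◇sat M X φ
  backward (H₀ , _ , H₁ , _ , H₂ , _ , X₃⊨=u₀ , _ ,
            (_ , _ , X₃⊆R∪S , _ , _ , lift R⊨v≡u₀ , lift S⊨v≡u₁) ,
            ((P , Q , X₃⊆P∪Q , _ , Q⊆X₃ , lift P⊨v≢u₁ , (_ , Q⊨φ)) , X₃⊨≠v)) =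
    X ∩ (_∈[ Other ] Q) , (λ _ → proj₁) , nonempty ,
    locality φ φ⊆Other Q≈[]X∩Q (sat-embed⇒sat Q φ Q⊨φ)
    where
      X₃ : Team M
      X₃ = supp M (supp M (supp M X u₀ H₀) u₁ H₁) v H₂

      X₃⊆[]X : X₃ ⊆[ Other ] X
      X₃⊆[]X = ⊆[]-trans (supp-⊆[] v (λ _ → proj₂ ∘ proj₂))
               (⊆[]-trans (supp-⊆[] u₁ (λ _ → proj₁ ∘ proj₂)) (supp-⊆[] u₀ (λ _ → proj₁)))

      Q≈[]X∩Q : Q ≈[ Other ] (X ∩ (_∈[ Other ] Q))
      Q≈[]X∩Q = ≈[]-∩ (⊆[]-trans (⊆⇒⊆[] Q⊆X₃) X₃⊆[]X)

      into-Q : ∀ t → X₃ t → t v ≡ t u₁ → Q t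
      into-Q t t∈X₃ tv≡tu₁ with X₃⊆P∪Q t t∈X₃
      ... | inj₁ t∈P = ⊥-elim (P⊨v≢u₁ t t∈P tv≡tu₁)
      ... | inj₂ t∈Q = t∈Q

      nonempty : Σ (Assignment M) (X ∩ (_∈[ Other ] Q))
      nonempty with ≠⟨⟩-elim {𝒟} X₃⊨≠v
      ... | _ , _ , s∈X₃ , s'∈X₃ , sv≢s'v
        with v≡u₁-somewhere (λ t t∈X₃ → Sum.map (R⊨v≡u₀ t) (S⊨v≡u₁ t) (X₃⊆R∪S t t∈X₃))
                            (=⟨⟩-elim {𝒟} X₃⊨=u₀) s∈X₃ s'∈X₃ sv≢s'v
      ... | t , t∈X₃ , tv≡tu₁ = let (s , s∈X∩Q , _) = proj₁ Q≈[]X∩Q t (into-Q t t∈X₃ tv≡tu₁) in s , s∈X∩Q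

lemma5p2 : (σ : Signature) (𝒟 : Family) (φ : Formula σ 𝒟) (u₀ u₁ v : Var) →
           ¬ (u₀ ≡ u₁) → ¬ (u₀ ≡ v) → ¬ (u₁ ≡ v) →
           ¬ Occ u₀ φ → ¬ Occ u₁ φ → ¬ Occ v φ →
           (M : Model σ) (X : Team M) →
           (◇sat M X φ → sat M X (diamondTranslation φ u₀ u₁ v)) ×
           (sat M X (diamondTranslation φ u₀ u₁ v) → ◇sat M X φ)
lemma5p2 σ 𝒟 φ u₀ u₁ v u₀≢u₁ u₀≢v u₁≢v u₀∉φ u₁∉φ v∉φ M X =
  (λ (Y , Y⊆X , Y≠∅ , Y⊨φ) → Forward.forward Y Y⊆X Y≠∅ Y⊨φ) , backward
  where open Diamond φ u₀ u₁ v u₀≢u₁ u₀≢v u₁≢v u₀∉φ u₁∉φ v∉φ M X
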